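{- Let $G_1=(V_1,E_1)$ and $G_2=(V_2,E_2)$ be two connected graphs with disjoint vertex sets, and let $x_1y_1\in E_1$ and $x_2y_2\in E_2$. Let $G_3=G_1(x_1y_1)+_H G_2(x_2y_2)$ be their Hajós sum. Then $\gamma_{coe}(G_3)\le \gamma_{coe}(G_1)+\gamma_{coe}(G_2)+1$.
   Context: All graphs are finite and simple. A dominating set of a graph $X=(V,E)$ is a set $D\subseteq V$ such that every vertex in $V\setminus D$ is adjacent to at least one vertex of $D$. A dominating set $D$ is a co-even dominating set if every vertex $v\in V\setminus D$ has even degree in $X$. The co-even domination number $\gamma_{coe}(X)$ is the minimum cardinality of a co-even dominating set of $X$. The Hajós sum $G_1(x_1y_1)+_H G_2(x_2y_2)$ is obtained from the disjoint union $(V_1\cup V_2,E_1\cup E_2)$ by deleting the edges $x_1y_1$ and $x_2y_2$, identifying the vertices $x_1$ and $x_2$ into a single vertex, and adding the edge $y_1y_2$. -}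

module Defs where

import Data.Nat
open import Data.Nat using (ℕ; suc; _%_)
open import Data.Bool using (Bool; true; false; _∧_; _∨_; not)
open import Data.Fin using (Fin; _↑ˡ_; _↑ʳ_; splitAt; punchIn)
open import Data.Fin.Properties using (_≟_)
open import Data.Fin.Subset using (Subset; _∈_; _∉_; ∣_∣)
open import Data.Vec using (tabulate)
open import Data.Sum using (inj₁; inj₂)
open import Data.Product using (∃; _×_)
open import Relation.Nullary.Decidable using (⌊_⌋)
open import Relation.Binary.PropositionalEquality using (_≡_; _≢_)

record Graph (n : ℕ) : Set where
  field
    adj : Fin n → Fin n → Bool
open Graph public

record IsSimple {n : ℕ} (G : Graph n) : Set where
  field
    sym     : ∀ u v → adj G u v ≡ adj G v u
    irrefl  : ∀ v → adj G v v ≡ false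
open IsSimple public

data Reach {n : ℕ} (G : Graph n) : Fin n → Fin n → Set where
  here : ∀ {v} → Reach G v v
  step : ∀ {u w v} → adj G u w ≡ true → Reach G w v → Reach G u v

Connected : ∀ {n} → Graph n → Set
Connected {n} G = ∀ (u v : Fin n) → Reach G u v

nbhd : ∀ {n} → Graph n → Fin n → Subset n
nbhd G v = tabulate (adj G v)

degree : ∀ {n} → Graph n → Fin n → ℕ
degree G v = ∣ nbhd G v ∣

IsDominating : ∀ {n} → Graph n → Subset n → Set
IsDominating {n} G D = ∀ (v : Fin n) → v ∉ D → ∃ λ u → u ∈ D × adj G v u ≡ true

IsCoEvenDominating : ∀ {n} → Graph n → Subset n → Set
IsCoEvenDominating {n} G D =
  IsDominating G D × (∀ (v : Fin n) → v ∉ D → degree G v % 2 ≡ 0)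

IsCoEvenDominationNumber : ∀ {n} → Graph n → ℕ → Set
IsCoEvenDominationNumber {n} G k =
  (∃ λ (D : Subset n) → IsCoEvenDominating G D × ∣ D ∣ ≡ k)
  × (∀ (D : Subset n) → IsCoEvenDominating G D → k Data.Nat.≤ ∣ D ∣)

_==_ : ∀ {n} → Fin n → Fin n → Bool
a == b = ⌊ a ≟ b ⌋

-- Vertex set Fin (n₁ + m): the first n₁ vertices are the vertices of G₁
-- (x₁ being the identified vertex x₁ = x₂), the last m are the vertices of
-- G₂ other than x₂, with j : Fin m standing for  punchIn x₂ j  in G₂.
hajos : ∀ {n₁ m} (G₁ : Graph n₁) (x₁ y₁ : Fin n₁)
        (G₂ : Graph (suc m)) (x₂ y₂ : Fin (suc m)) → Graph (n₁ Data.Nat.+ m)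
hajos {n₁} {m} G₁ x₁ y₁ G₂ x₂ y₂ = record { adj = A }
  where
    A₁ : Fin n₁ → Fin n₁ → Bool
    A₁ a b = adj G₁ a b ∧ not ((a == x₁ ∧ b == y₁) ∨ (a == y₁ ∧ b == x₁))
    A₂ : Fin (suc m) → Fin (suc m) → Bool
    A₂ a b = adj G₂ a b ∧ not ((a == x₂ ∧ b == y₂) ∨ (a == y₂ ∧ b == x₂))
    -- cross edges between a vertex a of G₁ and the vertex b ≠ x₂ of G₂:
    -- either a = x₁ (= x₂) and ab is an edge of G₂ − x₂y₂,
    -- or ab is the new edge y₁y₂.
    C : Fin n₁ → Fin (suc m) → Bool
    C a b = (a == x₁ ∧ A₂ x₂ b) ∨ (a == y₁ ∧ b == y₂)
    A : Fin (n₁ Data.Nat.+ m) → Fin (n₁ Data.Nat.+ m) → Bool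
    A u v with splitAt n₁ u | splitAt n₁ v
    ... | inj₁ a | inj₁ b = A₁ a b
    ... | inj₂ a | inj₂ b = A₂ (punchIn x₂ a) (punchIn x₂ b)
    ... | inj₁ a | inj₂ b = C a (punchIn x₂ b)
    ... | inj₂ a | inj₁ b = C b (punchIn x₂ a)

-- In G₃ every vertex other than the identified vertex x₁ = x₂ keeps its degree: y₁ and y₂ each
-- trade their edge to x₁ resp. x₂ for the new edge y₁y₂, and all other edges at such a vertex
-- survive.  So with x₁ in the dominating set no parity condition is disturbed.  Take D₁, the
-- trace of D₂ on G₂ − x₂, and x₁; if x₁ ∈ D₁ already, add y₁ instead (it may have been dominated
-- only along the deleted edge x₁y₁), and if x₂ ∈ D₂, let y₂ take its place.
module Submission where

open import Defs renaming (sym to adj-sym)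
open import Data.Nat using (ℕ; zero; suc; _+_; _≤_; _%_; z≤n; s≤s)
open import Data.Nat.Properties
  using (+-commutativeSemigroup; +-assoc; +-comm; +-identityʳ; +-suc; +-mono-≤; ≤-reflexive; ≤-trans; m≤n⇒m≤1+n; module ≤-Reasoning)
open import Data.Fin using (Fin; _↑ˡ_; _↑ʳ_; punchIn; punchOut)
import Data.Fin as Fin
open import Data.Fin.Properties using (_≟_; punchInᵢ≢i; punchIn-punchOut; splitAt-↑ˡ; splitAt-↑ʳ)
open import Data.Fin.Subset using (Subset; _∈_; _∉_; ∣_∣)
open import Data.Vec using ([]; _∷_; _++_; tabulate; lookup)
open import Data.Vec.Properties using (lookup∘tabulate; lookup-++ˡ; lookup-++ʳ; []=⇒lookup; lookup⇒[]=)
open import Data.Bool using (Bool; true; false; _∧_; _∨_; not; if_then_else_)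
open import Data.Bool.Properties using (∧-identityʳ; ∧-zeroʳ; ∨-identityʳ; ∨-zeroʳ)
open import Data.Sum using (_⊎_; inj₁; inj₂)
open import Data.Product using (∃; _×_; _,_; proj₁; proj₂)
open import Function using (_∘_)
open import Algebra.Properties.CommutativeSemigroup +-commutativeSemigroup using (x∙yz≈y∙xz; xy∙z≈xz∙y)
open import Relation.Nullary using (yes; no)
open import Relation.Nullary.Decidable using (isYes≗does; dec-true; dec-false)
open import Relation.Binary.PropositionalEquality
  using (_≡_; _≢_; refl; sym; trans; cong; cong₂; subst; module ≡-Reasoning)

bit : Bool → ℕ
bit true  = 1
bit false = 0

==-refl : ∀ {n} (a : Fin n) → (a == a) ≡ true
==-refl a = trans (isYes≗does (a ≟ a)) (dec-true (a ≟ a) refl)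

==-≢ : ∀ {n} {a b : Fin n} → a ≢ b → (a == b) ≡ false
==-≢ {a = a} {b} a≢b = trans (isYes≗does (a ≟ b)) (dec-false (a ≟ b) a≢b)

count : ∀ {n} → (Fin n → Bool) → ℕ
count {zero}  f = 0
count {suc n} f = bit (f Fin.zero) + count (f ∘ Fin.suc)

count-cong : ∀ {n} {f g : Fin n → Bool} → (∀ k → f k ≡ g k) → count f ≡ count g
count-cong {zero}  f≗g = refl
count-cong {suc n} f≗g = cong₂ _+_ (cong bit (f≗g Fin.zero)) (count-cong (f≗g ∘ Fin.suc))

count-false : ∀ {n} → count {n} (λ _ → false) ≡ 0
count-false {zero}  = refl
count-false {suc n} = count-false {n}

count-punchIn : ∀ {n} (f : Fin (suc n) → Bool) (i : Fin (suc n)) →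
                count f ≡ bit (f i) + count (f ∘ punchIn i)
count-punchIn f Fin.zero = refl
count-punchIn {suc n} f (Fin.suc i) =
  trans (cong (bit (f Fin.zero) +_) (count-punchIn (f ∘ Fin.suc) i))
        (x∙yz≈y∙xz (bit (f Fin.zero)) (bit (f (Fin.suc i))) _)

count-splitAt : ∀ n {m} (f : Fin (n + m) → Bool) →
                count f ≡ count (f ∘ (_↑ˡ m)) + count (f ∘ (n ↑ʳ_))
count-splitAt zero    f = refl
count-splitAt (suc n) f =
  trans (cong (bit (f Fin.zero) +_) (count-splitAt n (f ∘ Fin.suc)))
        (sym (+-assoc (bit (f Fin.zero)) _ _))

count-∨ : ∀ {n} (f g : Fin n → Bool) → count (λ k → f k ∨ g k) ≤ count f + count g
count-∨ {zero}  f g = z≤n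
count-∨ {suc n} f g with f Fin.zero | g Fin.zero | count-∨ (f ∘ Fin.suc) (g ∘ Fin.suc)
... | true  | true  | ih = s≤s (≤-trans (m≤n⇒m≤1+n ih) (≤-reflexive (sym (+-suc _ _))))
... | true  | false | ih = s≤s ih
... | false | true  | ih = ≤-trans (s≤s ih) (≤-reflexive (sym (+-suc _ _)))
... | false | false | ih = ih

count-single : ∀ {n} (f : Fin n → Bool) (c : Fin n) →
               (∀ k → k ≢ c → f k ≡ false) → count f ≡ bit (f c)
count-single {suc n} f c off-c = begin
  count f                                ≡⟨ count-punchIn f c ⟩
  bit (f c) + count (f ∘ punchIn c)      ≡⟨ cong (bit (f c) +_) (count-cong (λ j → off-c _ (punchInᵢ≢i c j))) ⟩
  bit (f c) + count {n} (λ _ → false)    ≡⟨ cong (bit (f c) +_) (count-false {n}) ⟩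
  bit (f c) + 0                          ≡⟨ +-identityʳ _ ⟩
  bit (f c)                              ∎
  where open ≡-Reasoning

count-== : ∀ {n} (c : Fin n) → count (_== c) ≡ 1
count-== c = trans (count-single (_== c) c (λ _ → ==-≢)) (cong bit (==-refl c))

count-==-∧ : ∀ {n} (c : Fin n) (b : Bool) → count (λ k → (k == c) ∧ b) ≡ bit b
count-==-∧ c b = trans (count-single _ c (λ _ k≢c → cong (_∧ b) (==-≢ k≢c)))
                       (cong (λ t → bit (t ∧ b)) (==-refl c))

count-punchIn-== : ∀ {n} {i c : Fin (suc n)} → i ≢ c → count (λ j → punchIn i j == c) ≡ 1
count-punchIn-== {i = i} {c} i≢c = begin
  count (λ j → punchIn i j == c)                 ≡⟨ cong (λ t → bit t + count (λ j → punchIn i j == c)) (==-≢ i≢c) ⟨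
  bit (i == c) + count (λ j → punchIn i j == c)  ≡⟨ count-punchIn (_== c) i ⟨
  count (_== c)                                  ≡⟨ count-== c ⟩
  1                                              ∎
  where open ≡-Reasoning

count-∨-== : ∀ {n} (f : Fin n → Bool) (c : Fin n) → count (λ k → f k ∨ (k == c)) ≤ count f + 1
count-∨-== f c = ≤-trans (count-∨ f (_== c)) (≤-reflexive (cong (count f +_) (count-== c)))

count-punchIn-transfer : ∀ {n} (f : Fin (suc n) → Bool) {i c : Fin (suc n)} → i ≢ c →
                         count (λ j → f (punchIn i j) ∨ (f i ∧ (punchIn i j == c))) ≤ count f
count-punchIn-transfer {n} f {i} {c} i≢c = begin
  count (λ j → f (punchIn i j) ∨ (f i ∧ (punchIn i j == c)))
    ≤⟨ count-∨ (f ∘ punchIn i) _ ⟩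
  count (f ∘ punchIn i) + count (λ j → f i ∧ (punchIn i j == c))
    ≡⟨ cong (count (f ∘ punchIn i) +_) (moved (f i)) ⟩
  count (f ∘ punchIn i) + bit (f i)  ≡⟨ +-comm (count (f ∘ punchIn i)) _ ⟩
  bit (f i) + count (f ∘ punchIn i)  ≡⟨ count-punchIn f i ⟨
  count f                            ∎
  where
  open ≤-Reasoning
  moved : ∀ b → count (λ j → b ∧ (punchIn i j == c)) ≡ bit b
  moved true  = count-punchIn-== i≢c
  moved false = count-false {n}

∣p∣≡count : ∀ {n} (p : Subset n) → ∣ p ∣ ≡ count (lookup p)
∣p∣≡count []          = refl
∣p∣≡count (true ∷ p)  = cong suc (∣p∣≡count p)
∣p∣≡count (false ∷ p) = ∣p∣≡count p

∣tabulate∣≡count : ∀ {n} (f : Fin n → Bool) → ∣ tabulate f ∣ ≡ count f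
∣tabulate∣≡count f = trans (∣p∣≡count (tabulate f)) (count-cong (lookup∘tabulate f))

∣p++q∣≡∣p∣+∣q∣ : ∀ {n m} (p : Subset n) (q : Subset m) → ∣ p ++ q ∣ ≡ ∣ p ∣ + ∣ q ∣
∣p++q∣≡∣p∣+∣q∣ []          q = refl
∣p++q∣≡∣p∣+∣q∣ (true ∷ p)  q = cong suc (∣p++q∣≡∣p∣+∣q∣ p q)
∣p++q∣≡∣p∣+∣q∣ (false ∷ p) q = ∣p++q∣≡∣p∣+∣q∣ p q

edge⇒≢ : ∀ {n} {G : Graph n} → IsSimple G → ∀ {x y} → adj G x y ≡ true → x ≢ y
edge⇒≢ simple {x} xy refl with trans (sym xy) (irrefl simple x)
... | ()

deleteEdge : ∀ {n} → Graph n → Fin n → Fin n → Graph n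
deleteEdge G x y = record
  { adj = λ a b → adj G a b ∧ not ((a == x ∧ b == y) ∨ (a == y ∧ b == x)) }

module _ {n} (G : Graph n) (x y : Fin n) where

  private
    ==-∧-≢ : ∀ {a b c d : Fin n} → a ≢ b ⊎ c ≢ d → (a == b ∧ c == d) ≡ false
    ==-∧-≢ (inj₁ a≢b) rewrite ==-≢ a≢b = refl
    ==-∧-≢ (inj₂ c≢d) rewrite ==-≢ c≢d = ∧-zeroʳ _

  adj-deleteEdge : ∀ {u v} → u ≢ x ⊎ v ≢ y → u ≢ y ⊎ v ≢ x →
                   adj (deleteEdge G x y) u v ≡ adj G u v
  adj-deleteEdge ≢xy ≢yx rewrite ==-∧-≢ ≢xy | ==-∧-≢ ≢yx = ∧-identityʳ _

  adj-deleteEdge-xy : adj (deleteEdge G x y) x y ≡ false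
  adj-deleteEdge-xy rewrite ==-refl x | ==-refl y = ∧-zeroʳ _

  adj-deleteEdge-yx : adj (deleteEdge G x y) y x ≡ false
  adj-deleteEdge-yx rewrite ==-refl x | ==-refl y = trans (cong (λ b → adj G y x ∧ not b) (∨-zeroʳ _)) (∧-zeroʳ _)

degree≡count-punchIn : ∀ {n} (G : Graph (suc n)) (u x : Fin (suc n)) →
                       degree G u ≡ bit (adj G u x) + count (adj G u ∘ punchIn x)
degree≡count-punchIn G u x = trans (∣tabulate∣≡count (adj G u)) (count-punchIn (adj G u) x)

degree≡count-splitAt : ∀ n {m} (G : Graph (n + m)) (u : Fin (n + m)) →
                       degree G u ≡ count (adj G u ∘ (_↑ˡ m)) + count (adj G u ∘ (n ↑ʳ_))
degree≡count-splitAt n G u = trans (∣tabulate∣≡count (adj G u)) (count-splitAt n (adj G u))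

data Block (n m : ℕ) : Fin (n + m) → Set where
  left  : ∀ a → Block n m (a ↑ˡ m)
  right : ∀ j → Block n m (n ↑ʳ j)

block : ∀ n m (u : Fin (n + m)) → Block n m u
block zero    m u = right u
block (suc n) m Fin.zero = left Fin.zero
block (suc n) m (Fin.suc u) with block n m u
... | left a  = left (Fin.suc a)
... | right j = right j

module Hajós {n₁ m : ℕ} (G₁ : Graph (suc n₁)) (x₁ y₁ : Fin (suc n₁))
             (G₂ : Graph (suc m)) (x₂ y₂ : Fin (suc m))
             (simple₁ : IsSimple G₁) (simple₂ : IsSimple G₂)
             (x₁y₁ : adj G₁ x₁ y₁ ≡ true) (x₂y₂ : adj G₂ x₂ y₂ ≡ true) where

  G₃ : Graph (suc n₁ + m)
  G₃ = hajos G₁ x₁ y₁ G₂ x₂ y₂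

  G₁′ : Graph (suc n₁)
  G₁′ = deleteEdge G₁ x₁ y₁

  G₂′ : Graph (suc m)
  G₂′ = deleteEdge G₂ x₂ y₂

  cross : Fin (suc n₁) → Fin (suc m) → Bool
  cross a b = (a == x₁ ∧ adj G₂′ x₂ b) ∨ (a == y₁ ∧ b == y₂)

  adj-left-left : ∀ a b → adj G₃ (a ↑ˡ m) (b ↑ˡ m) ≡ adj G₁′ a b
  adj-left-left a b rewrite splitAt-↑ˡ (suc n₁) a m | splitAt-↑ˡ (suc n₁) b m = refl

  adj-right-right : ∀ i j → adj G₃ (suc n₁ ↑ʳ i) (suc n₁ ↑ʳ j) ≡ adj G₂′ (punchIn x₂ i) (punchIn x₂ j)
  adj-right-right i j rewrite splitAt-↑ʳ (suc n₁) m i | splitAt-↑ʳ (suc n₁) m j = refl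

  adj-left-right : ∀ a j → adj G₃ (a ↑ˡ m) (suc n₁ ↑ʳ j) ≡ cross a (punchIn x₂ j)
  adj-left-right a j rewrite splitAt-↑ˡ (suc n₁) a m | splitAt-↑ʳ (suc n₁) m j = refl

  adj-right-left : ∀ j a → adj G₃ (suc n₁ ↑ʳ j) (a ↑ˡ m) ≡ cross a (punchIn x₂ j)
  adj-right-left j a rewrite splitAt-↑ʳ (suc n₁) m j | splitAt-↑ˡ (suc n₁) a m = refl

  x₂≢y₂ : x₂ ≢ y₂
  x₂≢y₂ = edge⇒≢ simple₂ x₂y₂

  x₁≢y₁ : x₁ ≢ y₁
  x₁≢y₁ = edge⇒≢ simple₁ x₁y₁

  cross-y₁ : ∀ b → cross y₁ b ≡ (b == y₂)
  cross-y₁ b rewrite ==-≢ (x₁≢y₁ ∘ sym) | ==-refl y₁ = refl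

  cross-≢ : ∀ {a} b → a ≢ x₁ → a ≢ y₁ → cross a b ≡ false
  cross-≢ b a≢x₁ a≢y₁ rewrite ==-≢ a≢x₁ | ==-≢ a≢y₁ = refl

  cross-y₂ : ∀ a → cross a y₂ ≡ (a == y₁)
  cross-y₂ a rewrite adj-deleteEdge-xy G₂ x₂ y₂ | ==-refl y₂ = cong₂ _∨_ (∧-zeroʳ (a == x₁)) (∧-identityʳ (a == y₁))

  cross-≢y₂ : ∀ a {b} → b ≢ x₂ → b ≢ y₂ → cross a b ≡ (a == x₁ ∧ adj G₂ b x₂)
  cross-≢y₂ a {b} b≢x₂ b≢y₂ = begin
    (a == x₁ ∧ adj G₂′ x₂ b) ∨ (a == y₁ ∧ b == y₂)
      ≡⟨ cong₂ (λ p q → (a == x₁ ∧ p) ∨ (a == y₁ ∧ q))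
               (trans (adj-deleteEdge G₂ x₂ y₂ (inj₂ b≢y₂) (inj₂ b≢x₂)) (adj-sym simple₂ x₂ b))
               (==-≢ b≢y₂) ⟩
    (a == x₁ ∧ adj G₂ b x₂) ∨ (a == y₁ ∧ false)  ≡⟨ cong ((a == x₁ ∧ adj G₂ b x₂) ∨_) (∧-zeroʳ (a == y₁)) ⟩
    (a == x₁ ∧ adj G₂ b x₂) ∨ false              ≡⟨ ∨-identityʳ _ ⟩
    a == x₁ ∧ adj G₂ b x₂                        ∎
    where open ≡-Reasoning

  edges-to-x₁ : ∀ a → a ≢ x₁ →
                bit (adj G₁′ a x₁) + count (λ j → cross a (punchIn x₂ j)) ≡ bit (adj G₁ a x₁)
  edges-to-x₁ a a≢x₁ with y₁ ≟ a
  ... | yes refl = begin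
    bit (adj G₁′ y₁ x₁) + count (λ j → cross y₁ (punchIn x₂ j))
      ≡⟨ cong₂ _+_ (cong bit (adj-deleteEdge-yx G₁ x₁ y₁)) (count-cong (cross-y₁ ∘ punchIn x₂)) ⟩
    count (λ j → punchIn x₂ j == y₂)  ≡⟨ count-punchIn-== x₂≢y₂ ⟩
    1                                 ≡⟨ cong bit (trans (adj-sym simple₁ y₁ x₁) x₁y₁) ⟨
    bit (adj G₁ y₁ x₁)                ∎
    where open ≡-Reasoning
  ... | no y₁≢a = begin
    bit (adj G₁′ a x₁) + count (λ j → cross a (punchIn x₂ j))
      ≡⟨ cong₂ _+_ (cong bit (adj-deleteEdge G₁ x₁ y₁ (inj₁ a≢x₁) (inj₁ a≢y₁)))
                   (count-cong (λ j → cross-≢ (punchIn x₂ j) a≢x₁ a≢y₁)) ⟩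
    bit (adj G₁ a x₁) + count {m} (λ _ → false)  ≡⟨ cong (bit (adj G₁ a x₁) +_) (count-false {m}) ⟩
    bit (adj G₁ a x₁) + 0                        ≡⟨ +-identityʳ _ ⟩
    bit (adj G₁ a x₁)                            ∎
    where
    open ≡-Reasoning
    a≢y₁ : a ≢ y₁
    a≢y₁ = y₁≢a ∘ sym

  edges-to-x₂ : ∀ b → b ≢ x₂ → count (λ a → cross a b) ≡ bit (adj G₂ b x₂)
  edges-to-x₂ b b≢x₂ with y₂ ≟ b
  ... | yes refl = begin
    count (λ a → cross a y₂)  ≡⟨ count-cong cross-y₂ ⟩
    count (_== y₁)            ≡⟨ count-== y₁ ⟩
    1                         ≡⟨ cong bit (trans (adj-sym simple₂ y₂ x₂) x₂y₂) ⟨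
    bit (adj G₂ y₂ x₂)        ∎
    where open ≡-Reasoning
  ... | no y₂≢b = trans (count-cong (λ a → cross-≢y₂ a b≢x₂ (y₂≢b ∘ sym))) (count-==-∧ x₁ (adj G₂ b x₂))

  degree-left : ∀ a → a ≢ x₁ → degree G₃ (a ↑ˡ m) ≡ degree G₁ a
  degree-left a a≢x₁ = begin
    degree G₃ (a ↑ˡ m)
      ≡⟨ degree≡count-splitAt (suc n₁) G₃ (a ↑ˡ m) ⟩
    count (adj G₃ (a ↑ˡ m) ∘ (_↑ˡ m)) + count (adj G₃ (a ↑ˡ m) ∘ (suc n₁ ↑ʳ_))
      ≡⟨ cong₂ _+_ (count-cong (adj-left-left a)) (count-cong (adj-left-right a)) ⟩
    count (adj G₁′ a) + crossings
      ≡⟨ cong (_+ crossings) (count-punchIn (adj G₁′ a) x₁) ⟩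
    bit (adj G₁′ a x₁) + count (adj G₁′ a ∘ punchIn x₁) + crossings
      ≡⟨ cong (λ t → bit (adj G₁′ a x₁) + t + crossings) (count-cong away-from-x₁) ⟩
    bit (adj G₁′ a x₁) + count (adj G₁ a ∘ punchIn x₁) + crossings
      ≡⟨ xy∙z≈xz∙y (bit (adj G₁′ a x₁)) _ _ ⟩
    bit (adj G₁′ a x₁) + crossings + count (adj G₁ a ∘ punchIn x₁)
      ≡⟨ cong (_+ count (adj G₁ a ∘ punchIn x₁)) (edges-to-x₁ a a≢x₁) ⟩
    bit (adj G₁ a x₁) + count (adj G₁ a ∘ punchIn x₁)
      ≡⟨ degree≡count-punchIn G₁ a x₁ ⟨
    degree G₁ a ∎
    where
    open ≡-Reasoning
    crossings = count (λ j → cross a (punchIn x₂ j))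
    away-from-x₁ : ∀ i → adj G₁′ a (punchIn x₁ i) ≡ adj G₁ a (punchIn x₁ i)
    away-from-x₁ i = adj-deleteEdge G₁ x₁ y₁ (inj₁ a≢x₁) (inj₂ (punchInᵢ≢i x₁ i))

  degree-right : ∀ j → degree G₃ (suc n₁ ↑ʳ j) ≡ degree G₂ (punchIn x₂ j)
  degree-right j = begin
    degree G₃ (suc n₁ ↑ʳ j)
      ≡⟨ degree≡count-splitAt (suc n₁) G₃ (suc n₁ ↑ʳ j) ⟩
    count (adj G₃ (suc n₁ ↑ʳ j) ∘ (_↑ˡ m)) + count (adj G₃ (suc n₁ ↑ʳ j) ∘ (suc n₁ ↑ʳ_))
      ≡⟨ cong₂ _+_ (count-cong (adj-right-left j)) (count-cong (adj-right-right j)) ⟩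
    count (λ a → cross a b) + count (adj G₂′ b ∘ punchIn x₂)
      ≡⟨ cong₂ _+_ (edges-to-x₂ b (punchInᵢ≢i x₂ j)) (count-cong away-from-x₂) ⟩
    bit (adj G₂ b x₂) + count (adj G₂ b ∘ punchIn x₂)
      ≡⟨ degree≡count-punchIn G₂ b x₂ ⟨
    degree G₂ b ∎
    where
    open ≡-Reasoning
    b = punchIn x₂ j
    away-from-x₂ : ∀ i → adj G₂′ b (punchIn x₂ i) ≡ adj G₂ b (punchIn x₂ i)
    away-from-x₂ i = adj-deleteEdge G₂ x₂ y₂ (inj₁ (punchInᵢ≢i x₂ j)) (inj₂ (punchInᵢ≢i x₂ i))

  module _ (D₁ : Subset (suc n₁)) (D₂ : Subset (suc m)) where

    extra₁ : Fin (suc n₁)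
    extra₁ = if lookup D₁ x₁ then y₁ else x₁

    inside₁ : Fin (suc n₁) → Bool
    inside₁ a = lookup D₁ a ∨ (a == extra₁)

    inside₂ : Fin (suc m) → Bool
    inside₂ b = lookup D₂ b ∨ (lookup D₂ x₂ ∧ (b == y₂))

    D₃ : Subset (suc n₁ + m)
    D₃ = tabulate inside₁ ++ tabulate (inside₂ ∘ punchIn x₂)

    ∣D₃∣≤∣D₁∣+∣D₂∣+1 : ∣ D₃ ∣ ≤ ∣ D₁ ∣ + ∣ D₂ ∣ + 1
    ∣D₃∣≤∣D₁∣+∣D₂∣+1 = begin
      ∣ D₃ ∣
        ≡⟨ ∣p++q∣≡∣p∣+∣q∣ (tabulate inside₁) _ ⟩
      ∣ tabulate inside₁ ∣ + ∣ tabulate (inside₂ ∘ punchIn x₂) ∣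
        ≡⟨ cong₂ _+_ (∣tabulate∣≡count inside₁) (∣tabulate∣≡count (inside₂ ∘ punchIn x₂)) ⟩
      count inside₁ + count (inside₂ ∘ punchIn x₂)
        ≤⟨ +-mono-≤ (count-∨-== (lookup D₁) extra₁) (count-punchIn-transfer (lookup D₂) x₂≢y₂) ⟩
      count (lookup D₁) + 1 + count (lookup D₂)
        ≡⟨ cong₂ (λ p q → p + 1 + q) (∣p∣≡count D₁) (∣p∣≡count D₂) ⟨
      ∣ D₁ ∣ + 1 + ∣ D₂ ∣
        ≡⟨ xy∙z≈xz∙y (∣ D₁ ∣) 1 (∣ D₂ ∣) ⟩
      ∣ D₁ ∣ + ∣ D₂ ∣ + 1 ∎
      where open ≤-Reasoning

    ∈D₃-left : ∀ {a} → inside₁ a ≡ true → a ↑ˡ m ∈ D₃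
    ∈D₃-left {a} a-inside = lookup⇒[]= (a ↑ˡ m) D₃
      (trans (lookup-++ˡ (tabulate inside₁) _ a) (trans (lookup∘tabulate inside₁ a) a-inside))

    ∈D₃-right : ∀ {j} → inside₂ (punchIn x₂ j) ≡ true → suc n₁ ↑ʳ j ∈ D₃
    ∈D₃-right {j} b-inside = lookup⇒[]= (suc n₁ ↑ʳ j) D₃
      (trans (lookup-++ʳ (tabulate inside₁) _ j) (trans (lookup∘tabulate (inside₂ ∘ punchIn x₂) j) b-inside))

    D₁⊆D₃ : ∀ {a} → a ∈ D₁ → a ↑ˡ m ∈ D₃
    D₁⊆D₃ {a} a∈D₁ = ∈D₃-left (cong (_∨ (a == extra₁)) ([]=⇒lookup a∈D₁))

    x₁∈D₃ : x₁ ↑ˡ m ∈ D₃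
    x₁∈D₃ = ∈D₃-left x₁-inside
      where
      x₁-inside : inside₁ x₁ ≡ true
      x₁-inside with lookup D₁ x₁
      ... | true  = refl
      ... | false = ==-refl x₁

    y₁∈D₃ : x₁ ∈ D₁ → y₁ ↑ˡ m ∈ D₃
    y₁∈D₃ x₁∈D₁ = ∈D₃-left (trans (cong (λ e → lookup D₁ y₁ ∨ (y₁ == e)) extra₁≡y₁)
                                  (trans (cong (lookup D₁ y₁ ∨_) (==-refl y₁)) (∨-zeroʳ _)))
      where
      extra₁≡y₁ : extra₁ ≡ y₁
      extra₁≡y₁ rewrite []=⇒lookup x₁∈D₁ = refl

    D₂⊆D₃ : ∀ {j} → punchIn x₂ j ∈ D₂ → suc n₁ ↑ʳ j ∈ D₃
    D₂⊆D₃ {j} b∈D₂ = ∈D₃-right (cong (_∨ (lookup D₂ x₂ ∧ (punchIn x₂ j == y₂))) ([]=⇒lookup b∈D₂))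

    y₂∈D₃ : ∀ {j} → x₂ ∈ D₂ → punchIn x₂ j ≡ y₂ → suc n₁ ↑ʳ j ∈ D₃
    y₂∈D₃ {j} x₂∈D₂ b≡y₂ = ∈D₃-right (trans
      (cong₂ (λ p q → lookup D₂ (punchIn x₂ j) ∨ (p ∧ q))
             ([]=⇒lookup x₂∈D₂) (trans (cong (_== y₂) b≡y₂) (==-refl y₂)))
      (∨-zeroʳ _))

    module _ (cd₁ : IsCoEvenDominating G₁ D₁) (cd₂ : IsCoEvenDominating G₂ D₂) where

      ≢x₁-outside : ∀ {a} → a ↑ˡ m ∉ D₃ → a ≢ x₁
      ≢x₁-outside a∉D₃ refl = a∉D₃ x₁∈D₃

      not-y₁x₁ : ∀ {a u} → a ↑ˡ m ∉ D₃ → u ∈ D₁ → a ≢ y₁ ⊎ u ≢ x₁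
      not-y₁x₁ {a} a∉D₃ u∈D₁ with a ≟ y₁
      ... | no a≢y₁  = inj₁ a≢y₁
      ... | yes refl = inj₂ λ { refl → a∉D₃ (y₁∈D₃ u∈D₁) }

      dominated-left : ∀ a → a ↑ˡ m ∉ D₃ → ∃ λ u → u ∈ D₃ × adj G₃ (a ↑ˡ m) u ≡ true
      dominated-left a a∉D₃ with proj₁ cd₁ a (a∉D₃ ∘ D₁⊆D₃)
      ... | u , u∈D₁ , au = u ↑ˡ m , D₁⊆D₃ u∈D₁ ,
        trans (adj-left-left a u)
              (trans (adj-deleteEdge G₁ x₁ y₁ (inj₁ (≢x₁-outside a∉D₃)) (not-y₁x₁ a∉D₃ u∈D₁)) au)

      dominated-right : ∀ j → suc n₁ ↑ʳ j ∉ D₃ → ∃ λ u → u ∈ D₃ × adj G₃ (suc n₁ ↑ʳ j) u ≡ true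
      dominated-right j b∉D₃ with proj₁ cd₂ (punchIn x₂ j) (b∉D₃ ∘ D₂⊆D₃)
      ... | u , u∈D₂ , bu with x₂ ≟ u
      ...   | yes refl = x₁ ↑ˡ m , x₁∈D₃ ,
        trans (adj-right-left j x₁)
              (trans (trans (cross-≢y₂ x₁ b≢x₂ (b∉D₃ ∘ y₂∈D₃ u∈D₂)) (cong (_∧ adj G₂ b x₂) (==-refl x₁))) bu)
        where
        b = punchIn x₂ j
        b≢x₂ = punchInᵢ≢i x₂ j
      ...   | no x₂≢u = suc n₁ ↑ʳ punchOut x₂≢u ,
        D₂⊆D₃ (subst (_∈ D₂) (sym (punchIn-punchOut x₂≢u)) u∈D₂) ,
        trans (adj-right-right j (punchOut x₂≢u))
              (trans (cong (adj G₂′ (punchIn x₂ j)) (punchIn-punchOut x₂≢u))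
                     (trans (adj-deleteEdge G₂ x₂ y₂ (inj₁ (punchInᵢ≢i x₂ j)) (inj₂ (x₂≢u ∘ sym))) bu))

      co-even-dominating : IsCoEvenDominating G₃ D₃
      co-even-dominating = dominating , even-outside
        where
        dominating : IsDominating G₃ D₃
        dominating v v∉D₃ with block (suc n₁) m v
        ... | left a  = dominated-left a v∉D₃
        ... | right j = dominated-right j v∉D₃

        even-outside : ∀ v → v ∉ D₃ → degree G₃ v % 2 ≡ 0
        even-outside v v∉D₃ with block (suc n₁) m v
        ... | left a  = trans (cong (_% 2) (degree-left a (≢x₁-outside v∉D₃))) (proj₂ cd₁ a (v∉D₃ ∘ D₁⊆D₃))
        ... | right j = trans (cong (_% 2) (degree-right j)) (proj₂ cd₂ (punchIn x₂ j) (v∉D₃ ∘ D₂⊆D₃))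

theorem4p1 : ∀ {n₁ m : ℕ} (G₁ : Graph n₁) (G₂ : Graph (suc m))
               (x₁ y₁ : Fin n₁) (x₂ y₂ : Fin (suc m)) →
               IsSimple G₁ → IsSimple G₂ →
               Connected G₁ → Connected G₂ →
               adj G₁ x₁ y₁ ≡ true → adj G₂ x₂ y₂ ≡ true →
               ∀ (k₁ k₂ k₃ : ℕ) →
               IsCoEvenDominationNumber G₁ k₁ →
               IsCoEvenDominationNumber G₂ k₂ →
               IsCoEvenDominationNumber (hajos G₁ x₁ y₁ G₂ x₂ y₂) k₃ →
               k₃ ≤ k₁ + k₂ + 1
theorem4p1 {zero} G₁ G₂ () y₁ x₂ y₂
theorem4p1 {suc n₁} G₁ G₂ x₁ y₁ x₂ y₂ simple₁ simple₂ _ _ x₁y₁ x₂y₂ _ _ _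
           ((D₁ , cd₁ , refl) , _) ((D₂ , cd₂ , refl) , _) (_ , minimal₃) =
  ≤-trans (minimal₃ (D₃ D₁ D₂) (co-even-dominating D₁ D₂ cd₁ cd₂)) (∣D₃∣≤∣D₁∣+∣D₂∣+1 D₁ D₂)
  where open Hajós G₁ x₁ y₁ G₂ x₂ y₂ simple₁ simple₂ x₁y₁ x₂y₂
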